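{- Let $k,\ell,i$ be positive integers with $i\geq 2$. Let $G$ be a $\{K^{*}_{k},S^{*}_{\ell}\}$-free graph and let $a$ be a vertex of $G$. Then there exists $\hat U\subseteq V(G)$ with $|\hat U|\leq f_{k,\ell}(i)$ such that $N^{i}_{G}(a)\subseteq N_G[\hat U]$ (i.e., $\hat U$ dominates $N^{i}_{G}(a)$).
   Context: All graphs are finite, simple and undirected. For $U\subseteq V(G)$, $N_G[U]$ is the union of the closed neighborhoods of vertices of $U$. $N^{i}_{G}(a)$ is the set of vertices at distance exactly $i$ from $a$ in $G$. A graph is $\mathcal{H}$-free if it contains no member of $\mathcal{H}$ as an induced subgraph. For $n\geq1$, $K^{*}_{n}$ is the graph with vertex set $\{x_1,\dots,x_n,y_1,\dots,y_n\}$ and edge set $\{x_ix_j:1\leq i<j\leq n\}\cup\{x_iy_i:1\leq i\leq n\}$; $S^{*}_{n}$ is the graph with vertex set $\{x\}\cup\{y_1,\dots,y_n\}\cup\{z_1,\dots,z_n\}$ and edge set $\{xy_i\}\cup\{y_iz_i\}$ ($1\leq i\leq n$). $R(s,t)$ denotes the Ramsey number. Define recursively $g_{k,\ell}(1)=1$ and $g_{k,\ell}(i)=R\bigl(k,(\ell-1)g_{k,\ell}(i-1)+1\bigr)-1$ for $i\geq2$, and for $i\geq 2$ let $f_{k,\ell}(i)=R(k,\ell)\,g_{k,\ell}(i)$. -}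

module Defs where

open import Data.Nat using (ℕ; zero; suc; _+_; _*_; _∸_; _≤_; _<_)
open import Data.Fin using (Fin)
open import Data.Fin.Properties using (_≟_)
open import Data.Fin.Subset using (Subset; _∈_; ∣_∣)
open import Data.Bool using (Bool; true; false)
open import Data.Sum using (_⊎_; inj₁; inj₂)
open import Data.Unit using (⊤; tt)
open import Data.Product using (Σ; ∃; _×_; _,_)
open import Relation.Nullary using (¬_)
open import Relation.Nullary.Decidable using (⌊_⌋)
open import Relation.Binary.PropositionalEquality using (_≡_; _≢_)
open import Function.Definitions using (Injective)

record Graph (V : Set) : Set where
  field
    adj    : V → V → Bool
    sym    : ∀ u v → adj u v ≡ adj v u
    irrefl : ∀ v → adj v v ≡ false
open Graph public

InducedIn : ∀ {W : Set} {n : ℕ} → Graph W → Graph (Fin n) → Set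
InducedIn {W} {n} H G =
  Σ (W → Fin n) λ φ → Injective _≡_ _≡_ φ × (∀ u v → adj H u v ≡ adj G (φ u) (φ v))

-- K*_n : vertices x_i = inj₁ i, y_i = inj₂ i ; x's form a clique, x_i y_i edges.
Kstar-adj : ∀ k → Fin k ⊎ Fin k → Fin k ⊎ Fin k → Bool
Kstar-adj k (inj₁ i) (inj₁ j) with ⌊ i ≟ j ⌋
... | true  = false
... | false = true
Kstar-adj k (inj₁ i) (inj₂ j) = ⌊ i ≟ j ⌋
Kstar-adj k (inj₂ i) (inj₁ j) = ⌊ i ≟ j ⌋
Kstar-adj k (inj₂ i) (inj₂ j) = false

-- S*_n : vertex x = inj₁ tt, y_i = inj₂ (inj₁ i), z_i = inj₂ (inj₂ i);
-- edges x y_i and y_i z_i.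
Sstar-adj : ∀ l → ⊤ ⊎ (Fin l ⊎ Fin l) → ⊤ ⊎ (Fin l ⊎ Fin l) → Bool
Sstar-adj l (inj₁ _) (inj₁ _) = false
Sstar-adj l (inj₁ _) (inj₂ (inj₁ _)) = true
Sstar-adj l (inj₁ _) (inj₂ (inj₂ _)) = false
Sstar-adj l (inj₂ (inj₁ _)) (inj₁ _) = true
Sstar-adj l (inj₂ (inj₂ _)) (inj₁ _) = false
Sstar-adj l (inj₂ (inj₁ i)) (inj₂ (inj₂ j)) = ⌊ i ≟ j ⌋
Sstar-adj l (inj₂ (inj₂ i)) (inj₂ (inj₁ j)) = ⌊ i ≟ j ⌋
Sstar-adj l (inj₂ (inj₁ _)) (inj₂ (inj₁ _)) = false
Sstar-adj l (inj₂ (inj₂ _)) (inj₂ (inj₂ _)) = false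

private
  Kstar-sym : ∀ k u v → Kstar-adj k u v ≡ Kstar-adj k v u
  Kstar-sym k (inj₁ i) (inj₁ j) with i ≟ j | j ≟ i
  ... | Relation.Nullary.yes _ | Relation.Nullary.yes _ = _≡_.refl
  ... | Relation.Nullary.no _  | Relation.Nullary.no _  = _≡_.refl
  ... | Relation.Nullary.yes p | Relation.Nullary.no q  = Data.Empty.⊥-elim (q (Relation.Binary.PropositionalEquality.sym p))
    where import Data.Empty
  ... | Relation.Nullary.no p  | Relation.Nullary.yes q = Data.Empty.⊥-elim (p (Relation.Binary.PropositionalEquality.sym q))
    where import Data.Empty
  Kstar-sym k (inj₁ i) (inj₂ j) with i ≟ j | j ≟ i
  ... | Relation.Nullary.yes _ | Relation.Nullary.yes _ = _≡_.refl
  ... | Relation.Nullary.no _  | Relation.Nullary.no _  = _≡_.refl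
  ... | Relation.Nullary.yes p | Relation.Nullary.no q  = Data.Empty.⊥-elim (q (Relation.Binary.PropositionalEquality.sym p))
    where import Data.Empty
  ... | Relation.Nullary.no p  | Relation.Nullary.yes q = Data.Empty.⊥-elim (p (Relation.Binary.PropositionalEquality.sym q))
    where import Data.Empty
  Kstar-sym k (inj₂ i) (inj₁ j) with i ≟ j | j ≟ i
  ... | Relation.Nullary.yes _ | Relation.Nullary.yes _ = _≡_.refl
  ... | Relation.Nullary.no _  | Relation.Nullary.no _  = _≡_.refl
  ... | Relation.Nullary.yes p | Relation.Nullary.no q  = Data.Empty.⊥-elim (q (Relation.Binary.PropositionalEquality.sym p))
    where import Data.Empty
  ... | Relation.Nullary.no p  | Relation.Nullary.yes q = Data.Empty.⊥-elim (p (Relation.Binary.PropositionalEquality.sym q))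
    where import Data.Empty
  Kstar-sym k (inj₂ i) (inj₂ j) = _≡_.refl

  Kstar-irr : ∀ k v → Kstar-adj k v v ≡ false
  Kstar-irr k (inj₁ i) with i ≟ i
  ... | Relation.Nullary.yes _ = _≡_.refl
  ... | Relation.Nullary.no p = Data.Empty.⊥-elim (p _≡_.refl)
    where import Data.Empty
  Kstar-irr k (inj₂ i) = _≡_.refl

  Sstar-sym : ∀ l u v → Sstar-adj l u v ≡ Sstar-adj l v u
  Sstar-sym l (inj₁ _) (inj₁ _) = _≡_.refl
  Sstar-sym l (inj₁ _) (inj₂ (inj₁ _)) = _≡_.refl
  Sstar-sym l (inj₁ _) (inj₂ (inj₂ _)) = _≡_.refl
  Sstar-sym l (inj₂ (inj₁ _)) (inj₁ _) = _≡_.refl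
  Sstar-sym l (inj₂ (inj₂ _)) (inj₁ _) = _≡_.refl
  Sstar-sym l (inj₂ (inj₁ _)) (inj₂ (inj₁ _)) = _≡_.refl
  Sstar-sym l (inj₂ (inj₂ _)) (inj₂ (inj₂ _)) = _≡_.refl
  Sstar-sym l (inj₂ (inj₁ i)) (inj₂ (inj₂ j)) with i ≟ j | j ≟ i
  ... | Relation.Nullary.yes _ | Relation.Nullary.yes _ = _≡_.refl
  ... | Relation.Nullary.no _  | Relation.Nullary.no _  = _≡_.refl
  ... | Relation.Nullary.yes p | Relation.Nullary.no q  = Data.Empty.⊥-elim (q (Relation.Binary.PropositionalEquality.sym p))
    where import Data.Empty
  ... | Relation.Nullary.no p  | Relation.Nullary.yes q = Data.Empty.⊥-elim (p (Relation.Binary.PropositionalEquality.sym q))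
    where import Data.Empty
  Sstar-sym l (inj₂ (inj₂ i)) (inj₂ (inj₁ j)) with i ≟ j | j ≟ i
  ... | Relation.Nullary.yes _ | Relation.Nullary.yes _ = _≡_.refl
  ... | Relation.Nullary.no _  | Relation.Nullary.no _  = _≡_.refl
  ... | Relation.Nullary.yes p | Relation.Nullary.no q  = Data.Empty.⊥-elim (q (Relation.Binary.PropositionalEquality.sym p))
    where import Data.Empty
  ... | Relation.Nullary.no p  | Relation.Nullary.yes q = Data.Empty.⊥-elim (p (Relation.Binary.PropositionalEquality.sym q))
    where import Data.Empty

  Sstar-irr : ∀ l v → Sstar-adj l v v ≡ false
  Sstar-irr l (inj₁ _) = _≡_.refl
  Sstar-irr l (inj₂ (inj₁ _)) = _≡_.refl
  Sstar-irr l (inj₂ (inj₂ _)) = _≡_.refl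

Kstar : ∀ k → Graph (Fin k ⊎ Fin k)
Kstar k = record { adj = Kstar-adj k ; sym = Kstar-sym k ; irrefl = Kstar-irr k }

Sstar : ∀ l → Graph (⊤ ⊎ (Fin l ⊎ Fin l))
Sstar l = record { adj = Sstar-adj l ; sym = Sstar-sym l ; irrefl = Sstar-irr l }

KSFree : ∀ {n} → ℕ → ℕ → Graph (Fin n) → Set
KSFree k l G = ¬ InducedIn (Kstar k) G × ¬ InducedIn (Sstar l) G

data Walk {n} (G : Graph (Fin n)) : Fin n → Fin n → ℕ → Set where
  here : ∀ {v} → Walk G v v 0
  step : ∀ {u w v m} → adj G u w ≡ true → Walk G w v m → Walk G u v (suc m)

AtDist : ∀ {n} → Graph (Fin n) → Fin n → ℕ → Fin n → Set
AtDist G a i v = Walk G a v i × (∀ m → m < i → ¬ Walk G a v m)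

InClosedNbhd : ∀ {n} → Graph (Fin n) → Subset n → Fin n → Set
InClosedNbhd G U v = ∃ λ u → u ∈ U × (u ≡ v ⊎ adj G u v ≡ true)

HasClique : ∀ {N} → Graph (Fin N) → ℕ → Set
HasClique {N} G s = Σ (Fin s → Fin N) λ φ → Injective _≡_ _≡_ φ ×
  (∀ i j → i ≢ j → adj G (φ i) (φ j) ≡ true)

HasIndep : ∀ {N} → Graph (Fin N) → ℕ → Set
HasIndep {N} G t = Σ (Fin t → Fin N) λ φ → Injective _≡_ _≡_ φ ×
  (∀ i j → adj G (φ i) (φ j) ≡ false)

RamseyProp : ℕ → ℕ → ℕ → Set
RamseyProp s t N = (G : Graph (Fin N)) → HasClique G s ⊎ HasIndep G t

IsRamseyNumber : ℕ → ℕ → ℕ → Set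
IsRamseyNumber s t N = RamseyProp s t N × (∀ M → M < N → ¬ RamseyProp s t M)

g : (ℕ → ℕ → ℕ) → ℕ → ℕ → ℕ → ℕ
g R k l zero = 1   -- unused (i ≥ 1 in the paper)
g R k l (suc zero) = 1
g R k l (suc (suc i)) = R k ((l ∸ 1) * g R k l (suc i) + 1) ∸ 1

f : (ℕ → ℕ → ℕ) → ℕ → ℕ → ℕ → ℕ
f R k l i = R k l * g R k l i

{-# OPTIONS --safe #-}
-- Call a comb a family of pairs x_j, w_j with x_j ~ w_j′ iff j = j′ and the w's independent.
-- By induction on i, a comb with its x's in N^(i-1)(a) and its w's in N^i(a) has at most g(i)
-- teeth. Given R(k, s) teeth one layer further out, where s = (l - 1) g(i) + 1, Ramsey yields a
-- clique among the x's (an induced K*_k) or s independent x's. A minimal set in the previous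
-- layer dominating those s vertices has private neighbours among them, so it is a comb of at most
-- g(i) teeth, and each of its vertices sees at most l - 1 of the x's, for otherwise it is the
-- centre of an induced S*_l whose leaves are the w's (two layers away, hence nonadjacent to it).
-- So s ≤ (l - 1) g(i), a contradiction: the next layer admits at most R(k, s) - 1 = g(i + 1).
-- For N^i(a) itself, take a maximal independent T ⊆ N^i(a) and a minimal M ⊆ N^(i-1)(a)
-- dominating T (again a comb, so |M| ≤ g(i)). For m ∈ M, the vertices of N^i(a) outside N(m)
-- reached from m through T are dominated by a minimal Y_m ⊆ T ∩ N(m); their private neighbours
-- form a comb with Y_m, and Ramsey with centre m gives |Y_m| < R(k, l). Every vertex of N^i(a)
-- is adjacent to M or reached from some m ∈ M through T, so ⋃ {m} ∪ Y_m dominates N^i(a).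
module Submission where

open import Defs renaming (sym to adj-sym)
open import Data.Bool using (true; false)
open import Data.Bool.Properties using (¬-not) renaming (_≟_ to _≟ᵇ_)
open import Data.Fin as Fin using (Fin; inject≤)
open import Data.Fin.Properties using (_≟_; all?; ¬∀⟶∃¬; inject≤-injective) renaming (any? to anyFin?)
open import Data.Fin.Subset as Subset using (Subset; ∣_∣; ⁅_⁆; _∪_)
open import Data.Fin.Subset.Properties using (∣⊥∣≡0; ∣⁅x⁆∣≡1; x∈⁅x⁆; x∈p∪q⁺)
open import Data.List using (List; []; _∷_; _++_; length; lookup; filter; map; allFin; concatMap; removeAt)
open import Data.List.Properties using (length-++; length-removeAt′; length-tabulate)
open import Data.List.Membership.Propositional using (_∈_; lose; find)
open import Data.List.Membership.Propositional.Properties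
  using (∈-lookup; ∈-filter⁺; ∈-filter⁻; ∈-allFin; ∈-map⁺; ∈-map⁻; ∈-concatMap⁺)
open import Data.List.Relation.Unary.All as All using (All; []; _∷_)
open import Data.List.Relation.Unary.All.Properties using (all-filter)
open import Data.List.Relation.Unary.Any as Any using (Any; here; there; any?)
open import Data.List.Relation.Unary.Any.Properties using (lookup-index)
open import Data.List.Relation.Unary.AllPairs using (_∷_)
open import Data.List.Relation.Unary.Unique.Propositional using (Unique)
import Data.List.Relation.Unary.Unique.Propositional.Properties as Uniqueₚ
open import Data.Nat using (ℕ; zero; suc; _+_; _*_; _∸_; _≤_; _<_; z≤n; s≤s; _≤?_)
open import Data.Nat.Properties hiding (_≟_)
open import Data.Product using (Σ; ∃; _×_; _,_; proj₁; proj₂)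
open import Data.Sum using (_⊎_; inj₁; inj₂)
open import Data.Unit using (⊤)
open import Data.Vec using ([]; _∷_)
open import Function using (_∘_)
open import Function.Definitions using (Injective)
open import Relation.Binary.PropositionalEquality
open import Relation.Binary.Definitions using (tri<; tri≈; tri>)
open import Relation.Nullary using (Dec; yes; no; ¬_; contradiction)
open import Relation.Nullary.Decidable using (⌊_⌋; map′; _×-dec_; ¬?)

∣p∪q∣≤∣p∣+∣q∣ : ∀ {n} (p q : Subset n) → ∣ p ∪ q ∣ ≤ ∣ p ∣ + ∣ q ∣
∣p∪q∣≤∣p∣+∣q∣ [] [] = z≤n
∣p∪q∣≤∣p∣+∣q∣ (true ∷ p) (true ∷ q) =
  s≤s (≤-trans (∣p∪q∣≤∣p∣+∣q∣ p q) (+-monoʳ-≤ ∣ p ∣ (n≤1+n _)))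
∣p∪q∣≤∣p∣+∣q∣ (true ∷ p) (false ∷ q) = s≤s (∣p∪q∣≤∣p∣+∣q∣ p q)
∣p∪q∣≤∣p∣+∣q∣ (false ∷ p) (true ∷ q) =
  ≤-trans (s≤s (∣p∪q∣≤∣p∣+∣q∣ p q)) (≤-reflexive (sym (+-suc ∣ p ∣ ∣ q ∣)))
∣p∪q∣≤∣p∣+∣q∣ (false ∷ p) (false ∷ q) = ∣p∪q∣≤∣p∣+∣q∣ p q

fromList : ∀ {n} → List (Fin n) → Subset n
fromList [] = Subset.⊥
fromList (x ∷ xs) = ⁅ x ⁆ ∪ fromList xs

∣fromList∣≤length : ∀ {n} (xs : List (Fin n)) → ∣ fromList xs ∣ ≤ length xs
∣fromList∣≤length {n} [] = ≤-reflexive (∣⊥∣≡0 n)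
∣fromList∣≤length (x ∷ xs) = begin
  ∣ ⁅ x ⁆ ∪ fromList xs ∣       ≤⟨ ∣p∪q∣≤∣p∣+∣q∣ ⁅ x ⁆ (fromList xs) ⟩
  ∣ ⁅ x ⁆ ∣ + ∣ fromList xs ∣   ≡⟨ cong (_+ ∣ fromList xs ∣) (∣⁅x⁆∣≡1 x) ⟩
  suc ∣ fromList xs ∣           ≤⟨ s≤s (∣fromList∣≤length xs) ⟩
  suc (length xs)               ∎
  where open ≤-Reasoning

∈-fromList⁺ : ∀ {n} {x : Fin n} {xs} → x ∈ xs → x Subset.∈ fromList xs
∈-fromList⁺ (here refl) = x∈p∪q⁺ (inj₁ (x∈⁅x⁆ _))
∈-fromList⁺ (there x∈xs) = x∈p∪q⁺ (inj₂ (∈-fromList⁺ x∈xs))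

≤∸1⊎≤ : ∀ r m → r ≤ m ∸ 1 ⊎ m ≤ r
≤∸1⊎≤ r m with m ≤? r
... | yes m≤r = inj₂ m≤r
... | no m≰r = inj₁ (subst (r ≤_) (pred[m∸n]≡m∸[1+n] m 0) (<⇒≤pred (≰⇒> m≰r)))

module _ {A : Set} where

  lookup-injective : ∀ {xs : List A} → Unique xs → Injective _≡_ _≡_ (lookup xs)
  lookup-injective (_ ∷ _) {Fin.zero} {Fin.zero} _ = refl
  lookup-injective (x∉xs ∷ _) {Fin.zero} {Fin.suc j} eq = contradiction eq (All.lookup x∉xs (∈-lookup j))
  lookup-injective (x∉xs ∷ _) {Fin.suc i} {Fin.zero} eq = contradiction (sym eq) (All.lookup x∉xs (∈-lookup i))
  lookup-injective (_ ∷ u) {Fin.suc i} {Fin.suc j} eq = cong Fin.suc (lookup-injective u eq)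

  ∈-removeAt⁺ : ∀ (xs : List A) {i j} → j ≢ i → lookup xs j ∈ removeAt xs i
  ∈-removeAt⁺ (x ∷ xs) {Fin.zero} {Fin.zero} j≢i = contradiction refl j≢i
  ∈-removeAt⁺ (x ∷ xs) {Fin.zero} {Fin.suc j} _ = ∈-lookup j
  ∈-removeAt⁺ (x ∷ xs) {Fin.suc i} {Fin.zero} _ = here refl
  ∈-removeAt⁺ (x ∷ xs) {Fin.suc i} {Fin.suc j} j≢i = there (∈-removeAt⁺ xs (j≢i ∘ cong Fin.suc))

  ∈-removeAt⁻ : ∀ (xs : List A) i {y} → y ∈ removeAt xs i → y ∈ xs
  ∈-removeAt⁻ (x ∷ xs) Fin.zero y∈ = there y∈
  ∈-removeAt⁻ (x ∷ xs) (Fin.suc i) (here refl) = here refl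
  ∈-removeAt⁻ (x ∷ xs) (Fin.suc i) (there y∈) = there (∈-removeAt⁻ xs i y∈)

  length≤filter+filter : ∀ {P : A → Set} (P? : ∀ x → Dec (P x)) (xs : List A) →
    length xs ≤ length (filter P? xs) + length (filter (¬? ∘ P?) xs)
  length≤filter+filter P? [] = z≤n
  length≤filter+filter P? (x ∷ xs) with P? x
  ... | yes _ = s≤s (length≤filter+filter P? xs)
  ... | no _ = ≤-trans (s≤s (length≤filter+filter P? xs)) (≤-reflexive (sym (+-suc _ _)))

module _ {A B : Set} where

  length-concatMap-≤ : ∀ (f : A → List B) c (xs : List A) →
    (∀ {x} → x ∈ xs → length (f x) ≤ c) → length (concatMap f xs) ≤ c * length xs
  length-concatMap-≤ f c [] _ = z≤n
  length-concatMap-≤ f c (x ∷ xs) bound = begin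
    length (f x ++ concatMap f xs)           ≡⟨ length-++ (f x) ⟩
    length (f x) + length (concatMap f xs)   ≤⟨ +-mono-≤ (bound (here refl)) (length-concatMap-≤ f c xs (bound ∘ there)) ⟩
    c + c * length xs                        ≡⟨ sym (*-suc c (length xs)) ⟩
    c * suc (length xs)                      ∎
    where open ≤-Reasoning

  length≤*-covered : ∀ {R : A → B → Set} (R? : ∀ x y → Dec (R x y)) c (Q : List A) (J : List B) → Unique J →
    (∀ {j} → j ∈ J → Any (λ q → R q j) Q) →
    (∀ {q} → q ∈ Q → ∀ (Js : List B) → Unique Js → All (R q) Js → length Js ≤ c) →
    length J ≤ c * length Q
  length≤*-covered R? c [] [] _ _ _ = z≤n
  length≤*-covered R? c [] (j ∷ J) _ covered _ with covered (here refl)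
  ... | ()
  length≤*-covered {R} R? c (q ∷ Q) J unique covered bound = begin
    length J                                               ≤⟨ length≤filter+filter (R? q) J ⟩
    length (filter (R? q) J) + length (filter notR? J)     ≤⟨ +-mono-≤ nearQ rest ⟩
    c + c * length Q                                       ≡⟨ sym (*-suc c (length Q)) ⟩
    c * suc (length Q)                                     ∎
    where
      open ≤-Reasoning
      notR? = ¬? ∘ R? q
      nearQ : length (filter (R? q) J) ≤ c
      nearQ = bound (here refl) _ (Uniqueₚ.filter⁺ (R? q) unique) (all-filter (R? q) J)
      coveredByQ : ∀ {j} → j ∈ filter notR? J → Any (λ q′ → R q′ j) Q
      coveredByQ j∈ with ∈-filter⁻ notR? {xs = J} j∈
      ... | j∈J , ¬Rqj with covered j∈J
      ...   | here Rqj = contradiction Rqj ¬Rqj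
      ...   | there any = any
      rest : length (filter notR? J) ≤ c * length Q
      rest = length≤*-covered R? c Q _ (Uniqueₚ.filter⁺ notR? unique) coveredByQ (bound ∘ there)

module _ {m : ℕ} where

  ⌊i≟i⌋ : ∀ (i : Fin m) → ⌊ i ≟ i ⌋ ≡ true
  ⌊i≟i⌋ i with i ≟ i
  ... | yes _ = refl
  ... | no i≢i = contradiction refl i≢i

  ⌊i≟j⌋⇒i≡j : ∀ {i j : Fin m} → ⌊ i ≟ j ⌋ ≡ true → i ≡ j
  ⌊i≟j⌋⇒i≡j {i} {j} eq with i ≟ j
  ... | yes i≡j = i≡j

  ⌊i≟j⌋-sym : ∀ (i j : Fin m) → ⌊ i ≟ j ⌋ ≡ ⌊ j ≟ i ⌋
  ⌊i≟j⌋-sym i j with i ≟ j | j ≟ i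
  ... | yes _ | yes _ = refl
  ... | no _ | no _ = refl
  ... | yes i≡j | no j≢i = contradiction (sym i≡j) j≢i
  ... | no i≢j | yes j≡i = contradiction (sym j≡i) i≢j

  ⌊φi≟φj⌋ : ∀ {r} {φ : Fin r → Fin m} → Injective _≡_ _≡_ φ → ∀ i j → ⌊ φ i ≟ φ j ⌋ ≡ ⌊ i ≟ j ⌋
  ⌊φi≟φj⌋ {φ = φ} φ-inj i j with φ i ≟ φ j | i ≟ j
  ... | yes _ | yes _ = refl
  ... | no _ | no _ = refl
  ... | yes φi≡φj | no i≢j = contradiction (φ-inj φi≡φj) i≢j
  ... | no φi≢φj | yes i≡j = contradiction (cong φ i≡j) φi≢φj

module Properties {n : ℕ} (G : Graph (Fin n)) where

  Edge : Fin n → Fin n → Set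
  Edge u v = adj G u v ≡ true

  edge? : ∀ u v → Dec (Edge u v)
  edge? u v = adj G u v ≟ᵇ true

  Edge-sym : ∀ {u v} → Edge u v → Edge v u
  Edge-sym {u} {v} e = trans (adj-sym G v u) e

  Edge⇒≢ : ∀ {u v} → Edge u v → u ≢ v
  Edge⇒≢ {u} e refl with trans (sym e) (irrefl G u)
  ... | ()

  ¬Edge⇒nonadjacent : ∀ {u v} → ¬ Edge u v → adj G u v ≡ false
  ¬Edge⇒nonadjacent = ¬-not

  walk-snoc : ∀ {a u v m} → Walk G a u m → Edge u v → Walk G a v (suc m)
  walk-snoc here e = step e here
  walk-snoc (step e′ w) e = step e′ (walk-snoc w e)

  walk-unsnoc : ∀ {a v m} → Walk G a v (suc m) → ∃ λ u → Walk G a u m × Edge u v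
  walk-unsnoc {a} (step e here) = a , here , e
  walk-unsnoc (step e (step e′ w)) with walk-unsnoc (step e′ w)
  ... | u , w′ , e″ = u , step e w′ , e″

  walk? : ∀ u v m → Dec (Walk G u v m)
  walk? u v zero = map′ (λ { refl → here }) (λ { here → refl }) (u ≟ v)
  walk? u v (suc m) = map′ (λ { (w , e , p) → step e p }) (λ { (step e p) → _ , e , p })
    (anyFin? (λ w → edge? u w ×-dec walk? w v m))

  atDist? : ∀ a i v → Dec (AtDist G a i v)
  atDist? a i v = walk? a v i ×-dec map′ (λ h m → h {m}) (λ h {m} → h m) (allUpTo? (λ m → ¬? (walk? a v m)) i)

  atDist-zero : ∀ {a v} → AtDist G a 0 v → v ≡ a
  atDist-zero (here , _) = refl

  atDist-pred : ∀ {a i v} → AtDist G a (suc i) v → ∃ λ u → AtDist G a i u × Edge u v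
  atDist-pred (w , shortest) with walk-unsnoc w
  ... | u , w′ , e = u , (w′ , λ m m<i w″ → shortest (suc m) (s≤s m<i) (walk-snoc w″ e)) , e

  atDist-functional : ∀ {a i j v} → AtDist G a i v → AtDist G a j v → i ≡ j
  atDist-functional {i = i} {j} (wi , shortest-i) (wj , shortest-j) with <-cmp i j
  ... | tri< i<j _ _ = contradiction wi (shortest-j i i<j)
  ... | tri≈ _ i≡j _ = i≡j
  ... | tri> _ _ j<i = contradiction wj (shortest-i j j<i)

  atDist-≢ : ∀ {a i j u v} → AtDist G a i u → AtDist G a j v → i ≢ j → u ≢ v
  atDist-≢ du dv i≢j refl = i≢j (atDist-functional du dv)

  atDist-edge : ∀ {a i j u v} → AtDist G a i u → AtDist G a j v → Edge u v → j ≤ suc i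
  atDist-edge {i = i} {j} (wu , _) (_ , shortest) e with j ≤? suc i
  ... | yes j≤1+i = j≤1+i
  ... | no j≰1+i = contradiction (walk-snoc wu e) (shortest (suc i) (≰⇒> j≰1+i))

  atDist-nonadjacent : ∀ {a i u v} → AtDist G a i u → AtDist G a (suc (suc i)) v → adj G u v ≡ false
  atDist-nonadjacent du dv = ¬Edge⇒nonadjacent (λ e → 1+n≰n (atDist-edge du dv e))

  Independent : ∀ {r} → (Fin r → Fin n) → Set
  Independent xs = ∀ j j′ → adj G (xs j) (xs j′) ≡ false

  Clique : ∀ {r} → (Fin r → Fin n) → Set
  Clique xs = ∀ j j′ → j ≢ j′ → Edge (xs j) (xs j′)

  Matched : ∀ {r} → (xs ws : Fin r → Fin n) → Set
  Matched xs ws = ∀ j j′ → adj G (xs j) (ws j′) ≡ ⌊ j ≟ j′ ⌋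

  module _ {r} {xs ws : Fin r → Fin n} (matched : Matched xs ws) where

    Matched-swap : Matched ws xs
    Matched-swap j j′ = trans (adj-sym G (ws j) (xs j′)) (trans (matched j′ j) (⌊i≟j⌋-sym j′ j))

    Matched⇒Edge : ∀ j → Edge (xs j) (ws j)
    Matched⇒Edge j = trans (matched j j) (⌊i≟i⌋ j)

    Matched⇒injective : Injective _≡_ _≡_ xs
    Matched⇒injective {i} {j} xsi≡xsj =
      sym (⌊i≟j⌋⇒i≡j (trans (sym (matched j i)) (trans (cong (λ x → adj G x (ws i)) (sym xsi≡xsj)) (Matched⇒Edge i))))

  record Comb (r : ℕ) : Set where
    field
      xs ws : Fin r → Fin n
      matched : Matched xs ws
      ws-independent : Independent ws

    xs≢ws : ∀ i j → xs i ≢ ws j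
    xs≢ws i j xsi≡wsj
      with trans (sym (Matched⇒Edge matched i)) (trans (cong (λ x → adj G x (ws i)) xsi≡wsj) (ws-independent j i))
    ... | ()

  restrict : ∀ {r s} → Comb r → (φ : Fin s → Fin r) → Injective _≡_ _≡_ φ → Comb s
  restrict C φ φ-inj = record
    { xs = xs ∘ φ
    ; ws = ws ∘ φ
    ; matched = λ j j′ → trans (matched (φ j) (φ j′)) (⌊φi≟φj⌋ φ-inj j j′)
    ; ws-independent = λ j j′ → ws-independent (φ j) (φ j′)
    }
    where open Comb C

  Comb⇒Kstar : ∀ {k} (C : Comb k) → Clique (Comb.xs C) → InducedIn (Kstar k) G
  Comb⇒Kstar {k} C clique = φ , (λ {u} {v} → injective u v) , preserves
    where
      open Comb C
      φ : Fin k ⊎ Fin k → Fin n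
      φ (inj₁ j) = xs j
      φ (inj₂ j) = ws j
      preserves : ∀ u v → adj (Kstar k) u v ≡ adj G (φ u) (φ v)
      preserves (inj₁ i) (inj₁ j) with i ≟ j
      ... | yes refl = sym (irrefl G (xs i))
      ... | no i≢j = sym (clique i j i≢j)
      preserves (inj₁ i) (inj₂ j) = sym (matched i j)
      preserves (inj₂ i) (inj₁ j) = sym (Matched-swap matched i j)
      preserves (inj₂ i) (inj₂ j) = sym (ws-independent i j)
      injective : ∀ u v → φ u ≡ φ v → u ≡ v
      injective (inj₁ i) (inj₁ j) eq = cong inj₁ (Matched⇒injective matched eq)
      injective (inj₁ i) (inj₂ j) eq = contradiction eq (xs≢ws i j)
      injective (inj₂ i) (inj₁ j) eq = contradiction (sym eq) (xs≢ws j i)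
      injective (inj₂ i) (inj₂ j) eq = cong inj₂ (Matched⇒injective (Matched-swap matched) eq)

  Comb⇒Sstar : ∀ {l} (C : Comb l) → Independent (Comb.xs C) → ∀ c →
    (∀ j → Edge c (Comb.xs C j)) → (∀ j → adj G c (Comb.ws C j) ≡ false) → (∀ j → c ≢ Comb.ws C j) →
    InducedIn (Sstar l) G
  Comb⇒Sstar {l} C xs-independent c c-xs c-ws c≢ws = φ , (λ {u} {v} → injective u v) , preserves
    where
      open Comb C
      φ : ⊤ ⊎ (Fin l ⊎ Fin l) → Fin n
      φ (inj₁ _) = c
      φ (inj₂ (inj₁ j)) = xs j
      φ (inj₂ (inj₂ j)) = ws j
      preserves : ∀ u v → adj (Sstar l) u v ≡ adj G (φ u) (φ v)
      preserves (inj₁ _) (inj₁ _) = sym (irrefl G c)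
      preserves (inj₁ _) (inj₂ (inj₁ j)) = sym (c-xs j)
      preserves (inj₁ _) (inj₂ (inj₂ j)) = sym (c-ws j)
      preserves (inj₂ (inj₁ j)) (inj₁ _) = sym (Edge-sym (c-xs j))
      preserves (inj₂ (inj₂ j)) (inj₁ _) = sym (trans (adj-sym G (ws j) c) (c-ws j))
      preserves (inj₂ (inj₁ i)) (inj₂ (inj₁ j)) = sym (xs-independent i j)
      preserves (inj₂ (inj₁ i)) (inj₂ (inj₂ j)) = sym (matched i j)
      preserves (inj₂ (inj₂ i)) (inj₂ (inj₁ j)) = sym (Matched-swap matched i j)
      preserves (inj₂ (inj₂ i)) (inj₂ (inj₂ j)) = sym (ws-independent i j)
      c≢xs : ∀ j → c ≢ xs j
      c≢xs j = Edge⇒≢ (c-xs j)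
      injective : ∀ u v → φ u ≡ φ v → u ≡ v
      injective (inj₁ _) (inj₁ _) _ = refl
      injective (inj₁ _) (inj₂ (inj₁ j)) eq = contradiction eq (c≢xs j)
      injective (inj₁ _) (inj₂ (inj₂ j)) eq = contradiction eq (c≢ws j)
      injective (inj₂ (inj₁ j)) (inj₁ _) eq = contradiction (sym eq) (c≢xs j)
      injective (inj₂ (inj₂ j)) (inj₁ _) eq = contradiction (sym eq) (c≢ws j)
      injective (inj₂ (inj₁ i)) (inj₂ (inj₁ j)) eq = cong (inj₂ ∘ inj₁) (Matched⇒injective matched eq)
      injective (inj₂ (inj₁ i)) (inj₂ (inj₂ j)) eq = contradiction eq (xs≢ws i j)
      injective (inj₂ (inj₂ i)) (inj₂ (inj₁ j)) eq = contradiction (sym eq) (xs≢ws j i)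
      injective (inj₂ (inj₂ i)) (inj₂ (inj₂ j)) eq = cong (inj₂ ∘ inj₂) (Matched⇒injective (Matched-swap matched) eq)

  swap : ∀ {r} (C : Comb r) → Independent (Comb.xs C) → Comb r
  swap C xs-independent = record
    { xs = ws
    ; ws = xs
    ; matched = Matched-swap matched
    ; ws-independent = xs-independent
    }
    where open Comb C

  ramsey-comb : ∀ {k s N r} → ¬ InducedIn (Kstar k) G → RamseyProp k s N → N ≤ r → (C : Comb r) →
    Σ (Fin s → Fin r) λ ψ → Injective _≡_ _≡_ ψ × Independent (Comb.xs C ∘ ψ)
  ramsey-comb {k} {s} {N} K*-free ramsey N≤r C = independentPart (ramsey H)
    where
      C′ = restrict C (λ j → inject≤ j N≤r) (inject≤-injective N≤r N≤r _ _)
      open Comb C′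
      H : Graph (Fin N)
      H = record { adj = λ i j → adj G (xs i) (xs j) ; sym = λ i j → adj-sym G (xs i) (xs j) ; irrefl = λ i → irrefl G (xs i) }
      independentPart : HasClique H k ⊎ HasIndep H s →
        Σ (Fin s → Fin _) λ ψ → Injective _≡_ _≡_ ψ × Independent (Comb.xs C ∘ ψ)
      independentPart (inj₁ (φ , φ-inj , clique)) = contradiction (Comb⇒Kstar (restrict C′ φ φ-inj) clique) K*-free
      independentPart (inj₂ (φ , φ-inj , independent)) =
        (λ j → inject≤ (φ j) N≤r) , φ-inj ∘ inject≤-injective N≤r N≤r _ _ , independent

  Dominates : List (Fin n) → List (Fin n) → Set
  Dominates Q B = ∀ {b} → b ∈ B → Any (λ q → Edge q b) Q

  PrivateNeighbour : (Q : List (Fin n)) → Fin (length Q) → Fin n → Set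
  PrivateNeighbour Q p b = ∀ p′ → adj G (lookup Q p′) b ≡ ⌊ p′ ≟ p ⌋

  privateNeighbour? : ∀ Q p b → Dec (PrivateNeighbour Q p b)
  privateNeighbour? Q p b = all? (λ p′ → adj G (lookup Q p′) b ≟ᵇ ⌊ p′ ≟ p ⌋)

  other-neighbour : ∀ Q p {b} → Edge (lookup Q p) b → ¬ PrivateNeighbour Q p b →
    ∃ λ p′ → p′ ≢ p × Edge (lookup Q p′) b
  other-neighbour Q p {b} e not-private with ¬∀⟶∃¬ _ _ (λ p′ → adj G (lookup Q p′) b ≟ᵇ ⌊ p′ ≟ p ⌋) not-private
  ... | p′ , wrong with p′ ≟ p
  ...   | yes refl = contradiction e wrong
  ...   | no p′≢p = p′ , p′≢p , ¬-not wrong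

  dominates-removeAt : ∀ {B} Q p → ¬ Any (PrivateNeighbour Q p) B → Dominates Q B → Dominates (removeAt Q p) B
  dominates-removeAt Q p no-private dominates {b} b∈B with Any.index (dominates b∈B) ≟ p | lookup-index (dominates b∈B)
  ... | no i≢p | e = lose {P = λ q → Edge q b} (∈-removeAt⁺ Q i≢p) e
  ... | yes refl | e with privateNeighbour? Q p b
  ...   | yes isPrivate = contradiction (lose b∈B isPrivate) no-private
  ...   | no not-private with other-neighbour Q p e not-private
  ...     | p′ , p′≢p , e′ = lose {P = λ q → Edge q b} (∈-removeAt⁺ Q p′≢p) e′

  record MinimalDominator (B Q : List (Fin n)) : Set where
    field
      members : List (Fin n)
      members⊆Q : ∀ {q} → q ∈ members → q ∈ Q
      dominates : Dominates members B
      privateNeighbour : Fin (length members) → Fin n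
      privateNeighbour∈B : ∀ p → privateNeighbour p ∈ B
      privateNeighbour-matched : Matched (lookup members) privateNeighbour

  opaque
    minimalDominator : ∀ B Q → Dominates Q B → MinimalDominator B Q
    minimalDominator B Q = prune (suc (length Q)) Q ≤-refl
      where
        prune : ∀ fuel Q → length Q < fuel → Dominates Q B → MinimalDominator B Q
        prune (suc fuel) Q |Q|<fuel dominates with all? (λ p → any? (privateNeighbour? Q p) B)
        ... | yes allPrivate = record
          { members = Q
          ; members⊆Q = λ q∈Q → q∈Q
          ; dominates = dominates
          ; privateNeighbour = λ p → proj₁ (find (allPrivate p))
          ; privateNeighbour∈B = λ p → proj₁ (proj₂ (find (allPrivate p)))
          ; privateNeighbour-matched = λ p′ p → proj₂ (proj₂ (find (allPrivate p))) p′
          }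
        ... | no not-all with ¬∀⟶∃¬ _ _ (λ p → any? (privateNeighbour? Q p) B) not-all
        ...   | p , no-private = record
          { MinimalDominator D hiding (members⊆Q)
          ; members⊆Q = λ q∈ → ∈-removeAt⁻ Q p (MinimalDominator.members⊆Q D q∈)
          }
          where
            D : MinimalDominator B (removeAt Q p)
            D = prune fuel (removeAt Q p)
                  (≤-pred (subst (λ m → suc m ≤ suc fuel) (length-removeAt′ Q p) |Q|<fuel))
                  (dominates-removeAt Q p no-private dominates)

  IndependentList : List (Fin n) → Set
  IndependentList T = ∀ {t t′} → t ∈ T → t′ ∈ T → adj G t t′ ≡ false

  IndependentList-∷ : ∀ {v acc} → IndependentList acc → (∀ {t} → t ∈ acc → adj G t v ≡ false) →
    IndependentList (v ∷ acc)
  IndependentList-∷ {v} _ _ (here refl) (here refl) = irrefl G v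
  IndependentList-∷ {v} _ v≁acc (here refl) (there t′∈) = trans (adj-sym G v _) (v≁acc t′∈)
  IndependentList-∷ _ v≁acc (there t∈) (here refl) = v≁acc t∈
  IndependentList-∷ acc-independent _ (there t∈) (there t′∈) = acc-independent t∈ t′∈

  record MaximalIndependent (P : Fin n → Set) (T : List (Fin n)) : Set where
    field
      members-P : ∀ {t} → t ∈ T → P t
      independent : IndependentList T
      maximal : ∀ {v} → P v → v ∈ T ⊎ Any (λ t → Edge t v) T

  module _ {P : Fin n → Set} (P? : ∀ v → Dec (P v)) where

    private
      record Greedy (vs acc T : List (Fin n)) : Set where
        field
          members-P : ∀ {t} → t ∈ T → P t
          independent : IndependentList T
          acc⊆T : ∀ {t} → t ∈ acc → t ∈ T
          covers : ∀ {v} → v ∈ vs → P v → v ∈ T ⊎ Any (λ t → Edge t v) T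

      greedy : ∀ vs acc → (∀ {t} → t ∈ acc → P t) → IndependentList acc → Σ (List (Fin n)) (Greedy vs acc)
      greedy [] acc acc-P acc-independent = acc , record
        { members-P = acc-P ; independent = acc-independent ; acc⊆T = λ t∈ → t∈ ; covers = λ () }
      greedy (v ∷ vs) acc acc-P acc-independent with any? (λ t → edge? t v) acc | P? v
      ... | yes v-covered | _ with greedy vs acc acc-P acc-independent
      ...   | T , inv = T , record
        { Greedy inv hiding (covers)
        ; covers = λ { (here refl) _ → inj₂ (acc-neighbour⇒T-neighbour v-covered) ; (there v∈) → Greedy.covers inv v∈ }
        }
        where
          acc-neighbour⇒T-neighbour : Any (λ t → Edge t v) acc → Any (λ t → Edge t v) T
          acc-neighbour⇒T-neighbour a with find a
          ... | t , t∈ , e = lose (Greedy.acc⊆T inv t∈) e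
      greedy (v ∷ vs) acc acc-P acc-independent | no _ | no ¬Pv with greedy vs acc acc-P acc-independent
      ...   | T , inv = T , record
        { Greedy inv hiding (covers)
        ; covers = λ { (here refl) Pv → contradiction Pv ¬Pv ; (there v∈) → Greedy.covers inv v∈ }
        }
      greedy (v ∷ vs) acc acc-P acc-independent | no v-uncovered | yes Pv
        with greedy vs (v ∷ acc) (λ { (here refl) → Pv ; (there t∈) → acc-P t∈ })
                    (IndependentList-∷ acc-independent (λ t∈ → ¬Edge⇒nonadjacent (λ e → v-uncovered (lose t∈ e))))
      ...   | T , inv = T , record
        { Greedy inv hiding (acc⊆T; covers)
        ; acc⊆T = λ t∈ → Greedy.acc⊆T inv (there t∈)
        ; covers = λ { (here refl) _ → inj₁ (Greedy.acc⊆T inv (here refl)) ; (there v∈) → Greedy.covers inv v∈ }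
        }

    opaque
      maximalIndependent : Σ (List (Fin n)) (MaximalIndependent P)
      maximalIndependent with greedy (allFin n) [] (λ ()) (λ ())
      ... | T , inv = T , record
        { members-P = Greedy.members-P inv
        ; independent = Greedy.independent inv
        ; maximal = Greedy.covers inv (∈-allFin _)
        }

module _ (R : ℕ → ℕ → ℕ) (isRamsey : ∀ s t → IsRamseyNumber s t (R s t)) (k l : ℕ)
         {n : ℕ} (G : Graph (Fin n)) (free : KSFree k l G) (a : Fin n) where

  open Properties G
  open Comb
  open MinimalDominator

  Layer : ℕ → Fin n → Set
  Layer = AtDist G a

  layer : ℕ → List (Fin n)
  layer i = filter (atDist? a i) (allFin n)

  ∈-layer⁺ : ∀ {i v} → Layer i v → v ∈ layer i
  ∈-layer⁺ {i} v∈ = ∈-filter⁺ (atDist? a i) (∈-allFin _) v∈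

  ∈-layer⁻ : ∀ {i v} → v ∈ layer i → Layer i v
  ∈-layer⁻ {i} v∈ = proj₂ (∈-filter⁻ (atDist? a i) {xs = allFin n} v∈)

  layer-dominates : ∀ {i B} → (∀ {b} → b ∈ B → Layer (suc i) b) → Dominates (layer i) B
  layer-dominates B⊆layer b∈B with atDist-pred (B⊆layer b∈B)
  ... | u , u∈layer , e = lose (∈-layer⁺ u∈layer) e

  MinimalDominator⇒Comb : ∀ {B Q} (D : MinimalDominator B Q) → IndependentList B → Comb (length (members D))
  MinimalDominator⇒Comb D B-independent = record
    { xs = lookup (members D)
    ; ws = privateNeighbour D
    ; matched = privateNeighbour-matched D
    ; ws-independent = λ j j′ → B-independent (privateNeighbour∈B D j) (privateNeighbour∈B D j′)
    }

  MinimalDominator⇒swapped-Comb : ∀ {B Q} (D : MinimalDominator B Q) → IndependentList Q → Comb (length (members D))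
  MinimalDominator⇒swapped-Comb D Q-independent = record
    { xs = privateNeighbour D
    ; ws = lookup (members D)
    ; matched = Matched-swap (privateNeighbour-matched D)
    ; ws-independent = λ j j′ → Q-independent (members⊆Q D (∈-lookup j)) (members⊆Q D (∈-lookup j′))
    }

  few-comb-neighbours : ∀ {s} (C : Comb s) → Independent (xs C) → ∀ q →
    (∀ j → adj G q (ws C j) ≡ false) → (∀ j → q ≢ ws C j) →
    ∀ Js → Unique Js → All (λ j → Edge q (xs C j)) Js → length Js ≤ l ∸ 1
  few-comb-neighbours C xs-independent q q-ws q≢ws Js Js-unique q-Js with ≤∸1⊎≤ (length Js) l
  ... | inj₁ few = few
  ... | inj₂ l≤|Js| = contradiction S* (proj₂ free)
    where
      φ : Fin l → Fin _
      φ j = lookup Js (inject≤ j l≤|Js|)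
      φ-injective : Injective _≡_ _≡_ φ
      φ-injective = inject≤-injective l≤|Js| l≤|Js| _ _ ∘ lookup-injective Js-unique
      S* = Comb⇒Sstar (restrict C φ φ-injective) (λ j j′ → xs-independent (φ j) (φ j′)) q
             (λ j → All.lookup q-Js (∈-lookup _)) (q-ws ∘ φ) (q≢ws ∘ φ)

  independent-comb-bound : ∀ i →
    (∀ {r} (C : Comb r) → (∀ j → Layer i (xs C j)) → (∀ j → Layer (suc i) (ws C j)) → r ≤ g R k l (suc i)) →
    ∀ {s} (D : Comb s) → Independent (xs D) →
    (∀ j → Layer (suc i) (xs D j)) → (∀ j → Layer (suc (suc i)) (ws D j)) →
    s ≤ (l ∸ 1) * g R k l (suc i)
  independent-comb-bound i bound {s} D xs-independent xs-layer ws-layer = begin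
    s                             ≡⟨ sym (length-tabulate {n = s} (λ j → j)) ⟩
    length (allFin s)             ≤⟨ length≤*-covered (λ q j → edge? q (xs D j)) (l ∸ 1) (members Q) (allFin s)
                                       (Uniqueₚ.allFin⁺ s) (λ _ → dominates Q (∈-map⁺ (xs D) (∈-allFin _))) few ⟩
    (l ∸ 1) * length (members Q)  ≤⟨ *-monoʳ-≤ (l ∸ 1) (bound (MinimalDominator⇒Comb Q B-independent)
                                       (λ j → ∈-layer⁻ (members⊆Q Q (∈-lookup j)))
                                       (λ j → B⊆layer (privateNeighbour∈B Q j))) ⟩
    (l ∸ 1) * g R k l (suc i)     ∎
    where
      open ≤-Reasoning
      B = map (xs D) (allFin s)
      B⊆layer : ∀ {b} → b ∈ B → Layer (suc i) b
      B⊆layer b∈B with ∈-map⁻ (xs D) b∈B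
      ... | j , _ , refl = xs-layer j
      B-independent : IndependentList B
      B-independent b∈B b′∈B with ∈-map⁻ (xs D) b∈B | ∈-map⁻ (xs D) b′∈B
      ... | j , _ , refl | j′ , _ , refl = xs-independent j j′
      Q = minimalDominator B (layer i) (layer-dominates B⊆layer)
      few : ∀ {q} → q ∈ members Q → ∀ Js → Unique Js → All (λ j → Edge q (xs D j)) Js → length Js ≤ l ∸ 1
      few q∈Q = few-comb-neighbours D xs-independent _
        (λ j → atDist-nonadjacent q-layer (ws-layer j)) (λ j → atDist-≢ q-layer (ws-layer j) (λ ()))
        where q-layer = ∈-layer⁻ (members⊆Q Q q∈Q)

  comb-bound : ∀ i {r} (C : Comb r) → (∀ j → Layer i (xs C j)) → (∀ j → Layer (suc i) (ws C j)) →
    r ≤ g R k l (suc i)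
  comb-bound zero {zero} _ _ _ = z≤n
  comb-bound zero {suc zero} _ _ _ = ≤-refl
  comb-bound zero {suc (suc r)} C xs-layer _
    with Matched⇒injective (matched C) (trans (atDist-zero (xs-layer Fin.zero)) (sym (atDist-zero (xs-layer (Fin.suc Fin.zero)))))
  ... | ()
  comb-bound (suc i) {r} C xs-layer ws-layer with ≤∸1⊎≤ r (R k ((l ∸ 1) * g R k l (suc i) + 1))
  ... | inj₁ r≤g = r≤g
  ... | inj₂ R≤r with ramsey-comb (proj₁ free) (proj₁ (isRamsey k _)) R≤r C
  ...   | ψ , ψ-injective , xs-independent =
    contradiction (independent-comb-bound i (comb-bound i) (restrict C ψ ψ-injective) xs-independent
                                          (xs-layer ∘ ψ) (ws-layer ∘ ψ))
                  (m+1+n≰m _)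

  module LayerDomination (i : ℕ) where

    T-max = maximalIndependent (atDist? a (suc i))
    T = proj₁ T-max
    open MaximalIndependent (proj₂ T-max)

    M : MinimalDominator T (layer i)
    M = minimalDominator T (layer i) (layer-dominates members-P)

    M-bound : length (members M) ≤ g R k l (suc i)
    M-bound = comb-bound i (MinimalDominator⇒Comb M independent)
      (λ j → ∈-layer⁻ (members⊆Q M (∈-lookup j))) (λ j → members-P (privateNeighbour∈B M j))

    A : Fin n → List (Fin n)
    A m = filter (edge? m) T

    Bridged : Fin n → Fin n → Set
    Bridged m v = Layer (suc i) v × ¬ Edge m v × Any (λ t → Edge m t × Edge t v) T

    bridged? : ∀ m v → Dec (Bridged m v)
    bridged? m v = atDist? a (suc i) v ×-dec ¬? (edge? m v) ×-dec any? (λ t → edge? m t ×-dec edge? t v) T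

    B : Fin n → List (Fin n)
    B m = filter (bridged? m) (allFin n)

    ∈-B : ∀ {m t v} → Layer (suc i) v → ¬ Edge m v → t ∈ T → Edge m t → Edge t v → v ∈ B m
    ∈-B {m} v-layer m≁v t∈T m~t t~v = ∈-filter⁺ (bridged? m) (∈-allFin _) (v-layer , m≁v , lose t∈T (m~t , t~v))

    opaque
      Y : ∀ m → MinimalDominator (B m) (A m)
      Y m = minimalDominator (B m) (A m) A-dominates
        where
          A-dominates : Dominates (A m) (B m)
          A-dominates v∈B with find (proj₂ (proj₂ (proj₂ (∈-filter⁻ (bridged? m) {xs = allFin n} v∈B))))
          ... | t , t∈T , m~t , t~v = lose (∈-filter⁺ (edge? m) t∈T m~t) t~v

    A⊆T : ∀ m {t} → t ∈ A m → t ∈ T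
    A⊆T m t∈A = proj₁ (∈-filter⁻ (edge? m) {xs = T} t∈A)

    Y-Comb : ∀ m → Comb (length (members (Y m)))
    Y-Comb m = MinimalDominator⇒swapped-Comb (Y m) (λ y∈ y′∈ → independent (A⊆T m y∈) (A⊆T m y′∈))

    Y-bound : ∀ {m} → m ∈ members M → suc (length (members (Y m))) ≤ R k l
    Y-bound {m} m∈M with R k l ≤? length (members (Y m))
    ... | no R≰|Y| = ≰⇒> R≰|Y|
    ... | yes R≤|Y| with ramsey-comb (proj₁ free) (proj₁ (isRamsey k l)) R≤|Y| (Y-Comb m)
    ...   | ψ , ψ-injective , privates-independent = contradiction S* (proj₂ free)
      where
        C = swap (restrict (Y-Comb m) ψ ψ-injective) privates-independent
        xs∈A : ∀ j → xs C j ∈ A m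
        xs∈A j = members⊆Q (Y m) (∈-lookup (ψ j))
        bridged : ∀ j → Bridged m (ws C j)
        bridged j = proj₂ (∈-filter⁻ (bridged? m) {xs = allFin n} (privateNeighbour∈B (Y m) (ψ j)))
        S* = Comb⇒Sstar C (λ j j′ → independent (A⊆T m (xs∈A j)) (A⊆T m (xs∈A j′))) m
               (λ j → proj₂ (∈-filter⁻ (edge? m) {xs = T} (xs∈A j)))
               (λ j → ¬Edge⇒nonadjacent (proj₁ (proj₂ (bridged j))))
               (λ j → atDist-≢ (∈-layer⁻ (members⊆Q M m∈M)) (proj₁ (bridged j)) (λ ()))

    local-dominators : Fin n → List (Fin n)
    local-dominators m = m ∷ members (Y m)

    U : List (Fin n)
    U = concatMap local-dominators (members M)

    U-bound : length U ≤ f R k l (suc i)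
    U-bound = ≤-trans (length-concatMap-≤ local-dominators (R k l) (members M) Y-bound)
                      (*-monoʳ-≤ (R k l) M-bound)

    U-dominates : ∀ v → Layer (suc i) v → InClosedNbhd G (fromList U) v
    U-dominates v v-layer with any? (λ m → edge? m v) (members M)
    ... | yes M~v with find M~v
    ...   | m , m∈M , m~v = m , ∈-fromList⁺ (∈-concatMap⁺ local-dominators (lose m∈M (here refl))) , inj₂ m~v
    U-dominates v v-layer | no M≁v with maximal v-layer
    ... | inj₁ v∈T = contradiction (dominates M v∈T) M≁v
    ... | inj₂ T~v with find T~v
    ...   | t , t∈T , t~v with find (dominates M t∈T)
    ...     | m , m∈M , m~t with find (dominates (Y m) (∈-B v-layer (M≁v ∘ lose m∈M) t∈T m~t t~v))
    ...       | y , y∈Y , y~v = y , ∈-fromList⁺ (∈-concatMap⁺ local-dominators (lose m∈M (there y∈Y))) , inj₂ y~v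

  layer-domination : ∀ i → Σ (Subset n) λ U → ∣ U ∣ ≤ f R k l (suc i) ×
    (∀ v → AtDist G a (suc i) v → InClosedNbhd G U v)
  layer-domination i = fromList U , ≤-trans (∣fromList∣≤length U) U-bound , U-dominates
    where open LayerDomination i

lemma2 : (R : ℕ → ℕ → ℕ) → (∀ s t → IsRamseyNumber s t (R s t)) →
    (k l i : ℕ) → 1 ≤ k → 1 ≤ l → 2 ≤ i →
    {n : ℕ} (G : Graph (Fin n)) → KSFree k l G → (a : Fin n) →
    Σ (Subset n) λ U → ∣ U ∣ ≤ f R k l i ×
      (∀ v → AtDist G a i v → InClosedNbhd G U v)
lemma2 R isRamsey k l (suc i) _ _ (s≤s _) G free a = layer-domination R isRamsey k l G free a i
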